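{- For bin packing with cardinality constraint $k=3$, every online algorithm has absolute competitive ratio at least $\frac74$.
   Context: Bin packing with cardinality constraints (BPCC): there is a global integer parameter $k\ge 2$; the input is a sequence of items with sizes in $(0,1]$. Items must be partitioned into bins so that each bin has total size at most $1$ and contains at most $k$ items; the goal is to minimize the number of bins. An online algorithm receives items one by one and must irrevocably assign each item to a bin before seeing the next item. For an algorithm $A$ and input $L$, $A(L)$ is the number of bins it uses and $OPT(L)$ the minimum possible number of bins. The absolute competitive ratio of $A$ is $\sup_L A(L)/OPT(L)$. -}

module Defs where

open import Data.Nat as ℕ using (ℕ; zero; suc)
open import Data.Integer using (+_)
open import Data.Rational using (ℚ; 0ℚ; 1ℚ; _/_; _+_; _-_; _*_; _≤_; _<_)
open import Data.List using (List; []; _∷_; _++_; [_]; length; zip; filter; map; deduplicate)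
open import Data.List.Relation.Unary.All using (All)
open import Data.Product using (_×_; proj₁; proj₂; Σ)
open import Relation.Binary.PropositionalEquality using (_≡_)
open import Relation.Nullary.Decidable using (⌊_⌋)
import Data.Nat.Properties as ℕP

ℕtoℚ : ℕ → ℚ
ℕtoℚ n = + n / 1

ValidSize : ℚ → Set
ValidSize x = (0ℚ < x) × (x ≤ 1ℚ)

ValidInput : List ℚ → Set
ValidInput L = All ValidSize L

-- A packing of L is a list of bin labels, one per item (same order).
-- Items (size, label) of bin b:
inBin : ℕ → List (ℚ × ℕ) → List (ℚ × ℕ)
inBin b = filter (λ p → proj₂ p ℕP.≟ b)

sumℚ : List ℚ → ℚ
sumℚ [] = 0ℚ
sumℚ (x ∷ xs) = x + sumℚ xs

load : ℕ → List ℚ → List ℕ → ℚ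
load b L P = sumℚ (map proj₁ (inBin b (zip L P)))

cardIn : ℕ → List ℚ → List ℕ → ℕ
cardIn b L P = length (inBin b (zip L P))

Feasible : ℕ → List ℚ → List ℕ → Set
Feasible k L P = (length P ≡ length L) ×
  ((b : ℕ) → (load b L P ≤ 1ℚ) × (cardIn b L P ℕ.≤ k))

numBins : List ℕ → ℕ
numBins P = length (deduplicate ℕP._≟_ P)

IsOPT : ℕ → List ℚ → ℕ → Set
IsOPT k L m = Σ (List ℕ) (λ P → Feasible k L P × (numBins P ≡ m))
            × ((P : List ℕ) → Feasible k L P → m ℕ.≤ numBins P)

-- A deterministic online algorithm: given the items seen so far (in order)
-- and the current item, it returns the label of the bin the current item
-- goes into (a fresh label = opening a new bin). Previous decisions are a
-- function of previous items, so this is the full information available.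
Assign : Set
Assign = List ℚ → ℚ → ℕ

runFrom : Assign → List ℚ → List ℚ → List ℕ
runFrom A hist [] = []
runFrom A hist (x ∷ xs) = A hist x ∷ runFrom A (hist ++ [ x ]) xs

run : Assign → List ℚ → List ℕ
run A L = runFrom A [] L

record OnlineAlg (k : ℕ) : Set where
  field
    assign : Assign
    valid  : (L : List ℚ) → ValidInput L → Feasible k L (run assign L)

cost : {k : ℕ} → OnlineAlg k → List ℚ → ℕ
cost A L = numBins (run (OnlineAlg.assign A) L)

module Submission where

-- The adversary starts with tiny items of size 1/12, then two items of size 1/3,
-- then two of size 5/12, and watches whether the algorithm puts each new item into
-- the bin of its predecessor of the same size.  As soon as the algorithm separates
-- two items it stops (or appends a few large items); if it never does, it appends
-- one item of size 1/2 and three of size 7/12.  In each of the five outcomes the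
-- input has an optimal packing with m bins and the algorithm uses n ≥ 7m/4 bins.

open import Defs
open import Data.Bool using (if_then_else_)
open import Data.Empty using (⊥-elim)
open import Data.Integer as ℤ using (+_)
import Data.Integer.Properties as ℤP
open import Data.List using (List; []; _∷_; length; zip; filter; map; deduplicate; upTo)
open import Data.List.Properties
  using (length-map; length-upTo; length-zipWith; filter-notAll; filter-none; filter-accept; filter-reject)
open import Data.List.Membership.Propositional using (_∈_; _∉_)
open import Data.List.Membership.Propositional.Properties using (∈-filter⁺; ∈-deduplicate⁺)
open import Data.List.Relation.Binary.Pointwise using (Pointwise; []; _∷_)
open import Data.List.Relation.Binary.Sublist.Propositional using (_⊆_; []; _∷_; _∷ʳ_)
open import Data.List.Relation.Binary.Sublist.Propositional.Properties using (filter-⊆; filter⁺; length-mono-≤)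
open import Data.List.Relation.Unary.All as All using (All; []; _∷_)
import Data.List.Relation.Unary.All.Properties as Allₚ
open import Data.List.Relation.Unary.AllPairs as AllPairs using (AllPairs; []; _∷_; allPairs?)
import Data.List.Relation.Unary.AllPairs.Properties as AllPairsₚ
import Data.List.Relation.Unary.Any as Any
open import Data.List.Relation.Unary.Any using (here; there)
open import Data.Nat as ℕ using (ℕ; suc; z≤n; s≤s; _≟_)
import Data.Nat.Properties as ℕP
open import Data.Nat.Coprimality as Coprime using (1-coprimeTo)
open import Data.List.Membership.DecPropositional _≟_ using (_∈?_)
open import Data.Product using (Σ; _×_; _,_; proj₁; proj₂)
open import Data.Product.Properties using () renaming (≡-dec to ×-≡-dec)
open import Data.Rational as ℚ using (ℚ; 0ℚ; 1ℚ; _/_; _+_; _-_; _*_; _≤_; _<_; mkℚ; *≤*; Positive)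
import Data.Rational.Properties as ℚP
open import Data.Sum using (_⊎_; inj₁; inj₂; [_,_]′)
open import Function using (_∘_)
open import Relation.Binary.Definitions using (DecidableEquality)
open import Relation.Binary.PropositionalEquality
  using (_≡_; _≢_; refl; sym; trans; cong; subst; subst₂; module ≡-Reasoning)
open import Relation.Nullary using (¬_; ¬?; yes; no; Dec; _×-dec_; _⊎-dec_)
open import Relation.Nullary.Decidable using (True; toWitness)
open import Relation.Unary using (Decidable)

-- A list of pairwise distinct elements, all occurring in ys, is no longer than ys:
-- removing the first element x from ys shortens ys and keeps the others in it.
distinct-length : ∀ {A : Set} → DecidableEquality A → (xs ys : List A) →
  AllPairs _≢_ xs → All (_∈ ys) xs → length xs ℕ.≤ length ys
distinct-length _≟_ [] ys _ _ = z≤n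
distinct-length _≟_ (x ∷ xs) ys (x≢xs ∷ distinct) (x∈ys ∷ xs∈ys) =
  ℕP.≤-trans (s≤s (distinct-length _≟_ xs ys′ distinct xs∈ys′))
             (filter-notAll (¬? ∘ (x ≟_)) ys (Any.map (λ x≡y x≢y → x≢y x≡y) x∈ys))
  where
  ys′ = filter (¬? ∘ (x ≟_)) ys
  xs∈ys′ : All (_∈ ys′) xs
  xs∈ys′ = All.zipWith (λ (x≢y , y∈ys) → ∈-filter⁺ (¬? ∘ (x ≟_)) y∈ys x≢y) (x≢xs , xs∈ys)

length-split : ∀ {A : Set} {P : A → Set} (P? : Decidable P) (xs : List A) →
  length (filter P? xs) ℕ.+ length (filter (¬? ∘ P?) xs) ≡ length xs
length-split P? [] = refl
length-split P? (x ∷ xs) with P? x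
... | yes _ = cong suc (length-split P? xs)
... | no  _ = trans (ℕP.+-suc _ _) (cong suc (length-split P? xs))

hasLabel? : ∀ b → Decidable (λ (p : ℚ × ℕ) → proj₂ p ≡ b)
hasLabel? b p = proj₂ p ≟ b

-- If every item carries a label from D and no label is carried by more than k items,
-- there are at most k·|D| items: peel off the items labelled by the head of D.
items≤capacity : ∀ k (D : List ℕ) (xs : List (ℚ × ℕ)) → All ((_∈ D) ∘ proj₂) xs →
  (∀ b → length (inBin b xs) ℕ.≤ k) → length xs ℕ.≤ k ℕ.* length D
items≤capacity k [] [] _ _ = z≤n
items≤capacity k [] (_ ∷ _) (() ∷ _) _
items≤capacity k (d ∷ D) xs labelled fits = begin
  length xs                                  ≡⟨ sym (length-split (hasLabel? d) xs) ⟩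
  length (inBin d xs) ℕ.+ length rest        ≤⟨ ℕP.+-mono-≤ (fits d) (items≤capacity k D rest restLabelled restFits) ⟩
  k ℕ.+ k ℕ.* length D                       ≡⟨ sym (ℕP.*-suc k (length D)) ⟩
  k ℕ.* length (d ∷ D)                       ∎
  where
  open ℕP.≤-Reasoning
  rest = filter (¬? ∘ hasLabel? d) xs
  restLabelled : All ((_∈ D) ∘ proj₂) rest
  restLabelled = All.zipWith (λ { (here l≡d , l≢d) → ⊥-elim (l≢d l≡d) ; (there l∈D , _) → l∈D })
                             (Allₚ.filter⁺ (¬? ∘ hasLabel? d) labelled , Allₚ.all-filter (¬? ∘ hasLabel? d) xs)
  restFits : ∀ b → length (inBin b rest) ℕ.≤ k
  restFits b = ℕP.≤-trans (length-mono-≤ (filter⁺ _ _ (λ { refl p → p }) (filter-⊆ (¬? ∘ hasLabel? d) xs))) (fits b)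

zip-labels : ∀ (L : List ℚ) (P : List ℕ) → All ((_∈ P) ∘ proj₂) (zip L P)
zip-labels [] P = []
zip-labels (x ∷ L) [] = []
zip-labels (x ∷ L) (l ∷ P) = here refl ∷ All.map there (zip-labels L P)

items≤k*bins : ∀ k L P → Feasible k L P → length L ℕ.≤ k ℕ.* numBins P
items≤k*bins k L P (sameLength , fits) = subst (ℕ._≤ k ℕ.* numBins P) zipLength
  (items≤capacity k (deduplicate _≟_ P) (zip L P)
     (All.map (∈-deduplicate⁺ _≟_) (zip-labels L P)) (proj₂ ∘ fits))
  where
  zipLength : length (zip L P) ≡ length L
  zipLength = begin
    length (zip L P)         ≡⟨ length-zipWith _,_ L P ⟩
    length L ℕ.⊓ length P    ≡⟨ cong (length L ℕ.⊓_) sameLength ⟩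
    length L ℕ.⊓ length L    ≡⟨ ℕP.⊓-idem (length L) ⟩
    length L                 ∎
    where open ≡-Reasoning

optimal : ∀ k L Q m → Feasible k L Q → numBins Q ≡ suc m → k ℕ.* m ℕ.< length L → IsOPT k L (suc m)
optimal k L Q m feasible uses crowded =
  (Q , feasible , uses) ,
  λ P feasibleP → ℕP.*-cancelˡ-< k m (numBins P) (ℕP.<-≤-trans crowded (items≤k*bins k L P feasibleP))

validInput? : ∀ L → Dec (ValidInput L)
validInput? = All.all? (λ x → (0ℚ ℚ.<? x) ×-dec (x ℚ.≤? 1ℚ))

BinFits : ℕ → List ℚ → List ℕ → ℕ → Set
BinFits k L P b = (load b L P ≤ 1ℚ) × (cardIn b L P ℕ.≤ k)

binFits? : ∀ k L P b → Dec (BinFits k L P b)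
binFits? k L P b = (load b L P ℚ.≤? 1ℚ) ×-dec (cardIn b L P ℕ.≤? k)

unused-bin-empty : ∀ b (L : List ℚ) P → b ∉ P → inBin b (zip L P) ≡ []
unused-bin-empty b L P b∉P =
  filter-none (hasLabel? b) (All.map (λ l∈P l≡b → b∉P (subst (_∈ P) l≡b l∈P)) (zip-labels L P))

feasible-if-used-bins-fit : ∀ k L P → length P ≡ length L → All (BinFits k L P) P → Feasible k L P
feasible-if-used-bins-fit k L P sameLength usedFit = sameLength , fits
  where
  fits : ∀ b → BinFits k L P b
  fits b with b ∈? P
  ... | yes b∈P = All.lookup usedFit b∈P
  ... | no  b∉P rewrite unused-bin-empty b L P b∉P = ℚP.nonNegative⁻¹ 1ℚ , z≤n

OptimalityCertificate : ℕ → List ℚ → List ℕ → ℕ → Set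
OptimalityCertificate k L Q m =
  (length Q ≡ length L) × All (BinFits k L Q) Q × (numBins Q ≡ suc m) × (k ℕ.* m ℕ.< length L)

optimalityCertificate? : ∀ k L Q m → Dec (OptimalityCertificate k L Q m)
optimalityCertificate? k L Q m =
  (length Q ≟ length L) ×-dec All.all? (binFits? k L Q) Q ×-dec (numBins Q ≟ suc m) ×-dec (k ℕ.* m ℕ.<? length L)

certified-optimal : ∀ k L Q m → OptimalityCertificate k L Q m → IsOPT k L (suc m)
certified-optimal k L Q m (sameLength , usedFit , uses , crowded) =
  optimal k L Q m (feasible-if-used-bins-fit k L Q sameLength usedFit) uses crowded

Follows : (ℕ → ℕ) → List ℕ → List ℕ → Set
Follows β P γ = Pointwise (λ l g → l ≡ β g) P γ

-- The bin label that P gives to the first item of group g (0 if g is empty);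
-- a packing that keeps every group in one bin follows γ under this labelling.
groupLabel : List ℕ → List ℕ → ℕ → ℕ
groupLabel (l ∷ P) (g′ ∷ γ) g = if g′ ℕ.≡ᵇ g then l else groupLabel P γ g
groupLabel _ _ _ = 0

groups⊆bin : ∀ {Q : ℕ → Set} (Q? : Decidable Q) β b (L : List ℚ) {P γ} → Follows β P γ →
  (∀ {g} → Q g → β g ≡ b) → map proj₁ (filter (Q? ∘ proj₂) (zip L γ)) ⊆ map proj₁ (inBin b (zip L P))
groups⊆bin Q? β b [] _ _ = []
groups⊆bin Q? β b (x ∷ L) [] _ = []
groups⊆bin Q? β b (x ∷ L) {l ∷ P} {g ∷ γ} (l≡βg ∷ follows) inB
  with Q? g | l ≟ b | groups⊆bin Q? β b L follows inB
... | yes Qg | _ | rest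
  rewrite filter-accept (hasLabel? b) {x = (x , l)} {xs = zip L P} (trans l≡βg (inB Qg)) = refl ∷ rest
... | no _ | yes l≡b | rest
  rewrite filter-accept (hasLabel? b) {x = (x , l)} {xs = zip L P} l≡b = x ∷ʳ rest
... | no _ | no l≢b | rest
  rewrite filter-reject (hasLabel? b) {x = (x , l)} {xs = zip L P} l≢b = rest

sum-mono-⊆ : ∀ {xs ys : List ℚ} → xs ⊆ ys → All (0ℚ ≤_) ys → sumℚ xs ≤ sumℚ ys
sum-mono-⊆ [] [] = ℚP.≤-refl
sum-mono-⊆ {xs} (y ∷ʳ xs⊆ys) (0≤y ∷ nonneg) =
  subst (_≤ y + _) (ℚP.+-identityˡ (sumℚ xs)) (ℚP.+-mono-≤ 0≤y (sum-mono-⊆ xs⊆ys nonneg))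
sum-mono-⊆ {ys = y ∷ _} (refl ∷ xs⊆ys) (_ ∷ nonneg) = ℚP.+-monoʳ-≤ y (sum-mono-⊆ xs⊆ys nonneg)

zip-sizes : ∀ {Q : ℚ → Set} {L : List ℚ} (P : List ℕ) → All Q L → All (Q ∘ proj₁) (zip L P)
zip-sizes _ [] = []
zip-sizes [] (_ ∷ _) = []
zip-sizes (_ ∷ P) (q ∷ qs) = q ∷ zip-sizes P qs

bin-sizes-nonneg : ∀ b (L : List ℚ) P → ValidInput L → All (0ℚ ≤_) (map proj₁ (inBin b (zip L P)))
bin-sizes-nonneg b L P valid =
  Allₚ.map⁺ (Allₚ.filter⁺ (hasLabel? b) (zip-sizes P (All.map (ℚP.<⇒≤ ∘ proj₁) valid)))

oneOf? : ∀ i j → Decidable (λ g → g ≡ i ⊎ g ≡ j)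
oneOf? i j g = (g ≟ i) ⊎-dec (g ≟ j)

pairSizes : List ℚ → List ℕ → ℕ → ℕ → List ℚ
pairSizes L γ i j = map proj₁ (filter (oneOf? i j ∘ proj₂) (zip L γ))

Incompatible : ℕ → List ℚ → List ℕ → ℕ → ℕ → Set
Incompatible k L γ i j = (k ℕ.< length (pairSizes L γ i j)) ⊎ (1ℚ < sumℚ (pairSizes L γ i j))

-- In a feasible packing that follows γ, incompatible groups are labelled differently:
-- otherwise both groups would lie in the single bin β i.
incompatible-apart : ∀ {k L P γ} β → Feasible k L P → ValidInput L → Follows β P γ →
  ∀ {i j} → Incompatible k L γ i j → β i ≢ β j
incompatible-apart {k} {L} {P} {γ} β (_ , fits) valid follows {i} {j} incompatible βi≡βj =
  [ tooMany , tooHeavy ]′ incompatible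
  where
  together : pairSizes L γ i j ⊆ map proj₁ (inBin (β i) (zip L P))
  together = groups⊆bin (oneOf? i j) β (β i) L follows λ { (inj₁ refl) → refl ; (inj₂ refl) → sym βi≡βj }
  tooMany : ¬ (k ℕ.< length (pairSizes L γ i j))
  tooMany = ℕP.≤⇒≯ (ℕP.≤-trans (length-mono-≤ together)
                     (ℕP.≤-trans (ℕP.≤-reflexive (length-map proj₁ (inBin (β i) (zip L P)))) (proj₂ (fits (β i)))))
  tooHeavy : ¬ (1ℚ < sumℚ (pairSizes L γ i j))
  tooHeavy 1<size = ℚP.<-irrefl refl (ℚP.<-≤-trans 1<size
    (ℚP.≤-trans (sum-mono-⊆ together (bin-sizes-nonneg (β i) L P valid)) (proj₁ (fits (β i)))))

Separated : ℕ → List ℚ → List ℕ → List (ℕ × ℕ) → ℕ → Set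
Separated k L γ E n = AllPairs (λ i j → Incompatible k L γ i j ⊎ (i , j) ∈ E) (upTo n) × All (_∈ γ) (upTo n)

separated? : ∀ k L γ E n → Dec (Separated k L γ E n)
separated? k L γ E n =
  allPairs? (λ i j → incompatible? i j ⊎-dec Any.any? ((i , j) ≟²_) E) (upTo n) ×-dec All.all? (_∈? γ) (upTo n)
  where
  _≟²_ : DecidableEquality (ℕ × ℕ)
  _≟²_ = ×-≡-dec _≟_ _≟_
  incompatible? : ∀ i j → Dec (Incompatible k L γ i j)
  incompatible? i j = (k ℕ.<? length (pairSizes L γ i j)) ⊎-dec (1ℚ ℚ.<? sumℚ (pairSizes L γ i j))

group-label-used : ∀ {β P γ g} → Follows β P γ → g ∈ γ → β g ∈ P
group-label-used (l≡βg ∷ _) (here refl) = here (sym l≡βg)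
group-label-used (_ ∷ follows) (there g∈γ) = there (group-label-used follows g∈γ)

bins-needed : ∀ {k L P γ} β E n → Feasible k L P → ValidInput L → Follows β P γ →
  All (λ (i , j) → β i ≢ β j) E → Separated k L γ E n → n ℕ.≤ numBins P
bins-needed {k} {L} {P} {γ} β E n feasible valid follows knownApart (separated , nonEmpty) =
  subst (ℕ._≤ numBins P) (trans (length-map β (upTo n)) (length-upTo n))
    (distinct-length _≟_ (map β (upTo n)) (deduplicate _≟_ P)
      (AllPairsₚ.map⁺ (AllPairs.map apart separated))
      (Allₚ.map⁺ (All.map (∈-deduplicate⁺ _≟_ ∘ group-label-used follows) nonEmpty)))
  where
  apart : ∀ {i j} → Incompatible k L γ i j ⊎ (i , j) ∈ E → β i ≢ β j
  apart (inj₁ incompatible) = incompatible-apart β feasible valid follows incompatible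
  apart (inj₂ known) = All.lookup knownApart known

ℕtoℚ-normal : ∀ n → ℕtoℚ n ≡ mkℚ (+ n) 0 (Coprime.sym (1-coprimeTo n))
ℕtoℚ-normal n = ℚP.normalize-coprime (Coprime.sym (1-coprimeTo n))

ℕtoℚ-mono : ∀ {m n} → m ℕ.≤ n → ℕtoℚ m ≤ ℕtoℚ n
ℕtoℚ-mono {m} {n} m≤n rewrite ℕtoℚ-normal m | ℕtoℚ-normal n =
  *≤* (subst₂ ℤ._≤_ (sym (ℤP.*-identityʳ (+ m))) (sym (ℤP.*-identityʳ (+ n))) (ℤ.+≤+ m≤n))

below-ratio : ∀ r ε m n c .{{_ : Positive (ℕtoℚ m)}} → 0ℚ < ε →
  r * ℕtoℚ m ≤ ℕtoℚ n → n ℕ.≤ c → (r - ε) * ℕtoℚ m < ℕtoℚ c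
below-ratio r ε m n c 0<ε rm≤n n≤c = begin-strict
  (r - ε) * ℕtoℚ m   <⟨ ℚP.*-monoˡ-<-pos (ℕtoℚ m) r-ε<r ⟩
  r * ℕtoℚ m         ≤⟨ rm≤n ⟩
  ℕtoℚ n             ≤⟨ ℕtoℚ-mono n≤c ⟩
  ℕtoℚ c             ∎
  where
  open ℚP.≤-Reasoning
  r-ε<r : r - ε < r
  r-ε<r = subst (r - ε <_) (ℚP.+-identityʳ r) (ℚP.+-monoʳ-< r (ℚP.neg-antimono-< 0<ε))

module Adversary (A : OnlineAlg 3) (ε : ℚ) (0<ε : 0ℚ < ε) where

  open OnlineAlg A renaming (assign to place; valid to placeFeasible)

  Goal : Set
  Goal = Σ (List ℚ) (λ L → ValidInput L × Σ ℕ (λ m → IsOPT 3 L m ×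
           (((+ 7 / 4) - ε) * ℕtoℚ m < ℕtoℚ (cost A L))))

  -- The adversary wins on input L if Q is a certified optimal packing of L into m+1 bins
  -- while the algorithm's packing of L follows the grouping γ with n ≥ 7(m+1)/4
  -- separated groups; E lists the pairs of groups the algorithm was seen to separate.
  wins : (L : List ℚ) (Q : List ℕ) (m : ℕ) (γ : List ℕ) (E : List (ℕ × ℕ)) (n : ℕ) →
         .{{_ : Positive (ℕtoℚ (suc m))}} →
         let P = run place L ; β = groupLabel P γ in
         Follows β P γ → All (λ (i , j) → β i ≢ β j) E →
         {True (validInput? L)} → {True (optimalityCertificate? 3 L Q m)} →
         {True (separated? 3 L γ E n)} → {True ((+ 7 / 4) * ℕtoℚ (suc m) ℚ.≤? ℕtoℚ n)} → Goal
  wins L Q m γ E n follows knownApart {valid} {optimal} {separated} {ratio} =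
    L , validL , suc m , certified-optimal 3 L Q m (toWitness optimal) ,
    below-ratio (+ 7 / 4) ε (suc m) n (cost A L) 0<ε (toWitness ratio)
      (bins-needed (groupLabel (run place L) γ) E n (placeFeasible L validL) validL follows knownApart
         (toWitness separated))
    where
    validL = toWitness valid

  tiny third medium half large twoThirds threeQuarters : ℚ
  tiny = + 1 / 12
  third = + 1 / 3
  medium = + 5 / 12
  half = + 1 / 2
  large = + 7 / 12
  twoThirds = + 2 / 3
  threeQuarters = + 3 / 4

  -- Tiny, third and medium items are offered in pairs or triples as long as the algorithm
  -- puts each of them into the bin of the first item of the same size.  Q is an optimal
  -- packing, γ groups the items as the algorithm was seen to pack them (so its packing
  -- follows γ by the recorded decisions), and n counts the groups.
  adversary : Goal
  adversary with place (tiny ∷ []) tiny ≟ place [] tiny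
  ... | no tiny₂-apart =
    wins (tiny ∷ tiny ∷ []) (0 ∷ 0 ∷ []) 0
         (0 ∷ 1 ∷ []) ((0 , 1) ∷ []) 2
         (refl ∷ refl ∷ []) ((tiny₂-apart ∘ sym) ∷ [])
  ... | yes tiny₂-joins with place (tiny ∷ tiny ∷ []) tiny ≟ place [] tiny
  ...   | no tiny₃-apart =
    wins (tiny ∷ tiny ∷ tiny ∷ []) (0 ∷ 0 ∷ 0 ∷ []) 0
         (0 ∷ 0 ∷ 1 ∷ []) ((0 , 1) ∷ []) 2
         (refl ∷ tiny₂-joins ∷ refl ∷ []) ((tiny₃-apart ∘ sym) ∷ [])
  ...   | yes tiny₃-joins
    with place (tiny ∷ tiny ∷ tiny ∷ third ∷ []) third ≟ place (tiny ∷ tiny ∷ tiny ∷ []) third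
  -- The thirds are separated; an item of size 3/4 fits into none of the three open bins:
  -- 4 bins, OPT = 2.
  ...     | no third₂-apart =
    wins (tiny ∷ tiny ∷ tiny ∷ third ∷ third ∷ threeQuarters ∷ [])
         (0 ∷ 0 ∷ 1 ∷ 1 ∷ 1 ∷ 0 ∷ []) 1
         (0 ∷ 0 ∷ 0 ∷ 1 ∷ 2 ∷ 3 ∷ []) ((1 , 2) ∷ []) 4
         (refl ∷ tiny₂-joins ∷ tiny₃-joins ∷ refl ∷ refl ∷ refl ∷ [])
         ((third₂-apart ∘ sym) ∷ [])
  ...     | yes third₂-joins
    with place (tiny ∷ tiny ∷ tiny ∷ third ∷ third ∷ medium ∷ []) medium
           ≟ place (tiny ∷ tiny ∷ tiny ∷ third ∷ third ∷ []) medium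
  -- The mediums are separated; three items of size 2/3 fit neither into an open bin nor
  -- together: 7 bins, OPT = 4.
  ...       | no medium₂-apart =
    wins (tiny ∷ tiny ∷ tiny ∷ third ∷ third ∷ medium ∷ medium ∷ twoThirds ∷ twoThirds ∷ twoThirds ∷ [])
         (2 ∷ 2 ∷ 3 ∷ 0 ∷ 1 ∷ 3 ∷ 3 ∷ 0 ∷ 1 ∷ 2 ∷ []) 3
         (0 ∷ 0 ∷ 0 ∷ 1 ∷ 1 ∷ 2 ∷ 3 ∷ 4 ∷ 5 ∷ 6 ∷ []) ((2 , 3) ∷ []) 7
         (refl ∷ tiny₂-joins ∷ tiny₃-joins ∷ refl ∷ third₂-joins ∷ refl ∷ refl ∷ refl ∷ refl ∷ refl ∷ [])
         ((medium₂-apart ∘ sym) ∷ [])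
  -- All same-size items are paired; one item of size 1/2 and three of size 7/12
  -- fit into no open bin nor with each other: 7 bins, OPT = 4.
  ...       | yes medium₂-joins =
    wins (tiny ∷ tiny ∷ tiny ∷ third ∷ third ∷ medium ∷ medium ∷ half ∷ large ∷ large ∷ large ∷ [])
         (1 ∷ 2 ∷ 3 ∷ 1 ∷ 2 ∷ 0 ∷ 3 ∷ 3 ∷ 0 ∷ 1 ∷ 2 ∷ []) 3
         (0 ∷ 0 ∷ 0 ∷ 1 ∷ 1 ∷ 2 ∷ 2 ∷ 3 ∷ 4 ∷ 5 ∷ 6 ∷ []) [] 7
         (refl ∷ tiny₂-joins ∷ tiny₃-joins ∷ refl ∷ third₂-joins ∷ refl ∷ medium₂-joins ∷
          refl ∷ refl ∷ refl ∷ refl ∷ [])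
         []

mainTheorem2 : (A : OnlineAlg 3) → (ε : ℚ) → 0ℚ < ε →
    Σ (List ℚ) (λ L → ValidInput L × Σ ℕ (λ m → IsOPT 3 L m ×
    (((+ 7 / 4) - ε) * ℕtoℚ m < ℕtoℚ (cost A L))))
mainTheorem2 A ε 0<ε = Adversary.adversary A ε 0<ε
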